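{- Let $G$ be a simple graph on $n$ vertices with $m\ge1$ edges. For $0\le r\le m$ let $G_{p_r}$ be the random subgraph of $G$ obtained by keeping each edge of $G$ independently with probability $p_r=r/m$. Then for every $0\le r\le m$, $$\mathbb{P}\bigl(|E(G_{p_r})|=r\bigr)\ge\frac1n.$$ -}

module Defs where

open import Data.Bool using (Bool; true; false; if_then_else_; _∧_)
open import Data.Nat as ℕ using (ℕ; zero; suc; _≡ᵇ_)
open import Data.Fin using (Fin; _<?_)
open import Data.List using (List; []; _∷_; [_]; concatMap; allFin; map; length; foldr)
open import Data.Product using (_×_; _,_)
open import Data.Integer using (+_)
open import Data.Rational using (ℚ; 0ℚ; 1ℚ; _+_; _*_; _-_; _/_)
open import Relation.Binary.PropositionalEquality using (_≡_)
open import Relation.Nullary.Decidable using (isYes)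

record SimpleGraph (n : ℕ) : Set where
  field
    adj    : Fin n → Fin n → Bool
    sym    : ∀ i j → adj i j ≡ adj j i
    irrefl : ∀ i → adj i i ≡ false
open SimpleGraph public

edges : ∀ {n} → SimpleGraph n → List (Fin n × Fin n)
edges {n} G =
  concatMap (λ i → concatMap (λ j →
      if adj G i j ∧ isYes (i <? j) then [ (i , j) ] else [])
    (allFin n)) (allFin n)

numEdges : ∀ {n} → SimpleGraph n → ℕ
numEdges G = length (edges G)

-- All keep/delete masks of length k (one Bool per edge; true = edge kept).
masks : ℕ → List (List Bool)
masks zero    = [] ∷ []
masks (suc k) = map (true ∷_) (masks k) Data.List.++ map (false ∷_) (masks k)

select : ∀ {A : Set} → List Bool → List A → List A
select (true  ∷ bs) (x ∷ xs) = x ∷ select bs xs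
select (false ∷ bs) (x ∷ xs) = select bs xs
select _ _ = []

weight : ℚ → List Bool → ℚ
weight p []           = 1ℚ
weight p (true  ∷ bs) = p * weight p bs
weight p (false ∷ bs) = (1ℚ - p) * weight p bs

sumℚ : List ℚ → ℚ
sumℚ = foldr _+_ 0ℚ

probEdgeCount : ∀ {n} → SimpleGraph n → ℚ → ℕ → ℚ
probEdgeCount G p r =
  sumℚ (map (λ b → if length (select b (edges G)) ≡ᵇ r then weight p b else 0ℚ)
            (masks (numEdges G)))

-- a / b as a rational; only used with b ≥ 1 (value at b = 0 is an irrelevant junk 0).
frac : ℕ → ℕ → ℚ
frac a zero    = 0ℚ
frac a (suc b) = (+ a) / suc b

{-# OPTIONS --safe #-}
-- The number of kept edges is Bin(m, r/m), and with k = m − r,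
-- P(Bin(m, r/m) = r) = m! r^r k^k / (m^m r! k!) =: 1/R(r, k). The quantity
-- Λ(r, k) = (r + k) R(r, k)² / (r k) satisfies Λ(1, k) = φ(k) and
-- Λ(r + 1, k) / Λ(r, k) = φ(r + k) / φ(r), where φ(x) = (1 + 1/x)^(2x+1). Since φ decreases
-- (for a = x(x + 2) and N = 2x + 1, already the first four terms of the binomial expansion of
-- (a + 1)^N show φ(x + 1) ≤ φ(x)), Λ ≤ φ(1) = 8. Hence R² ≤ 8rk/m ≤ 2m ≤ n², the last step
-- because a simple graph on n vertices has at most n²/2 edges.
module Submission where

open import Defs using (SimpleGraph; adj; edges; numEdges; masks; select; weight; sumℚ; probEdgeCount; frac)
open import Algebra.Properties.AbelianGroup as AbelianGroupProperties using ()
open import Algebra.Properties.CommutativeMonoid.Sum as Sum using ()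
open import Data.Bool using (Bool; true; false; if_then_else_; _∧_)
open import Data.Fin as Fin using (Fin; zero; suc)
import Data.Fin.Properties as Fin
open import Data.Integer as ℤ using (+≤+)
import Data.Integer.Properties as ℤ
open import Data.Integer.Tactic.RingSolver using () renaming (solve-∀ to ℤ-solve-∀)
open import Data.List using (List; []; _∷_; [_]; _++_; map; length; concatMap; tabulate)
open import Data.List.Properties using (length-++; map-++; map-∘)
open import Data.Nat
open import Data.Nat.Combinatorics using (_C_; nC1≡n; nCk+nC[k+1]≡[n+1]C[k+1])
open import Data.Nat.Properties
open import Data.Nat.Tactic.RingSolver using (solve; solve-∀)
open import Data.Product using (_×_; _,_)
open import Data.Rational as ℚ using (ℚ; 0ℚ; 1ℚ) renaming (_≤_ to _≤ℚ_)
import Data.Rational.Properties as ℚ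
import Data.Rational.Unnormalised as ℚᵘ
import Data.Rational.Unnormalised.Properties as ℚᵘ
open import Data.Sum using ([_,_]′)
open import Function using (_∘_; id)
open import Relation.Binary.PropositionalEquality hiding ([_])
open import Relation.Nullary using (yes; no; contradiction)
open import Relation.Nullary.Decidable using (isYes)
open import Algebra.Properties.CommutativeSemigroup *-commutativeSemigroup using (x∙yz≈y∙xz)
open Sum +-0-commutativeMonoid using (sum-syntax; sum-cong-≗; ∑-comm; ∑-distrib-+)

-- The decreasing sequence (1 + 1/x)^(2x+1)

2*[1+n]C2≡[1+n]*n : ∀ n → 2 * (suc n C 2) ≡ suc n * n
2*[1+n]C2≡[1+n]*n zero    = refl
2*[1+n]C2≡[1+n]*n (suc n) = begin
  2 * (suc (suc n) C 2)        ≡⟨ cong (2 *_) (nCk+nC[k+1]≡[n+1]C[k+1] (suc n) 1) ⟨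
  2 * (suc n C 1 + suc n C 2)  ≡⟨ cong (λ c → 2 * (c + suc n C 2)) (nC1≡n (suc n)) ⟩
  2 * (suc n + suc n C 2)      ≡⟨ *-distribˡ-+ 2 (suc n) _ ⟩
  2 * suc n + 2 * (suc n C 2)  ≡⟨ cong (2 * suc n +_) (2*[1+n]C2≡[1+n]*n n) ⟩
  2 * suc n + suc n * n        ≡⟨ solve (n ∷ []) ⟩
  suc (suc n) * suc n          ∎
  where open ≡-Reasoning

6*[2+n]C3≡[2+n]*[1+n]*n : ∀ n → 6 * (suc (suc n) C 3) ≡ suc (suc n) * suc n * n
6*[2+n]C3≡[2+n]*[1+n]*n zero    = refl
6*[2+n]C3≡[2+n]*[1+n]*n (suc n) = begin
  6 * (3+n C 3)                    ≡⟨ cong (6 *_) (nCk+nC[k+1]≡[n+1]C[k+1] 2+n 2) ⟨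
  6 * (2+n C 2 + 2+n C 3)          ≡⟨ regroup (2+n C 2) (2+n C 3) ⟩
  3 * (2 * (2+n C 2)) + 6 * (2+n C 3)
    ≡⟨ cong₂ (λ c d → 3 * c + d) (2*[1+n]C2≡[1+n]*n (suc n)) (6*[2+n]C3≡[2+n]*[1+n]*n n) ⟩
  3 * (2+n * suc n) + 2+n * suc n * n ≡⟨ factor n ⟩
  3+n * 2+n * suc n                ∎
  where
  open ≡-Reasoning
  factor : ∀ n → 3 * (suc (suc n) * suc n) + suc (suc n) * suc n * n ≡ suc (suc (suc n)) * suc (suc n) * suc n
  factor = solve-∀
  regroup : ∀ a b → 6 * (a + b) ≡ 3 * (2 * a) + 6 * b
  regroup = solve-∀
  2+n = suc (suc n)
  3+n = suc 2+n

^-distribʳ-* : ∀ m n o → (m * n) ^ o ≡ m ^ o * n ^ o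
^-distribʳ-* m n zero    = refl
^-distribʳ-* m n (suc o) = begin
  m * n * (m * n) ^ o      ≡⟨ cong (m * n *_) (^-distribʳ-* m n o) ⟩
  m * n * (m ^ o * n ^ o)  ≡⟨ swap m n (m ^ o) (n ^ o) ⟩
  m * m ^ o * (n * n ^ o)  ∎
  where
  open ≡-Reasoning
  swap : ∀ a b c d → a * b * (c * d) ≡ a * c * (b * d)
  swap = solve-∀

-- Σ_{i ≤ 3} C(N, i) a^(3 − i); times a^N / a³ these are the first four terms of (a + 1)^N.
binomialHead : ℕ → ℕ → ℕ
binomialHead a N = a * a * a + N * (a * a) + (N C 2) * a + N C 3

[1+a]*binomialHead : ∀ a N → suc a * binomialHead a N ≡ a * binomialHead a (suc N) + N C 3
[1+a]*binomialHead a N = begin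
  suc a * binomialHead a N                                       ≡⟨ expand a N (N C 2) (N C 3) ⟩
  a * (a * a * a + suc N * (a * a) + (N + N C 2) * a + (N C 2 + N C 3)) + N C 3
    ≡⟨ cong₂ (λ c₂ c₃ → a * (a * a * a + suc N * (a * a) + c₂ * a + c₃) + N C 3) [1+N]C2 [1+N]C3 ⟩
  a * binomialHead a (suc N) + N C 3                             ∎
  where
  open ≡-Reasoning
  expand : ∀ a N c₂ c₃ → suc a * (a * a * a + N * (a * a) + c₂ * a + c₃)
                       ≡ a * (a * a * a + suc N * (a * a) + (N + c₂) * a + (c₂ + c₃)) + c₃
  expand = solve-∀
  [1+N]C2 : N + N C 2 ≡ suc N C 2
  [1+N]C2 = trans (cong (_+ N C 2) (sym (nC1≡n N))) (nCk+nC[k+1]≡[n+1]C[k+1] N 1)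
  [1+N]C3 : N C 2 + N C 3 ≡ suc N C 3
  [1+N]C3 = nCk+nC[k+1]≡[n+1]C[k+1] N 2

a^N*binomialHead≤a³*[1+a]^N : ∀ a N → a ^ N * binomialHead a N ≤ a * a * a * suc a ^ N
a^N*binomialHead≤a³*[1+a]^N a zero = ≤-reflexive (base a)
  where
  base : ∀ a → 1 * (a * a * a + 0 * (a * a) + 0 * a + 0) ≡ a * a * a * 1
  base = solve-∀
a^N*binomialHead≤a³*[1+a]^N a (suc N) = begin
  a * a ^ N * binomialHead a (suc N)          ≡⟨ *-assoc a (a ^ N) _ ⟩
  a * (a ^ N * binomialHead a (suc N))        ≡⟨ x∙yz≈y∙xz a (a ^ N) _ ⟩
  a ^ N * (a * binomialHead a (suc N))        ≤⟨ *-monoʳ-≤ (a ^ N) (m≤m+n _ (N C 3)) ⟩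
  a ^ N * (a * binomialHead a (suc N) + N C 3) ≡⟨ cong (a ^ N *_) ([1+a]*binomialHead a N) ⟨
  a ^ N * (suc a * binomialHead a N)          ≡⟨ x∙yz≈y∙xz (a ^ N) (suc a) _ ⟩
  suc a * (a ^ N * binomialHead a N)          ≤⟨ *-monoʳ-≤ (suc a) (a^N*binomialHead≤a³*[1+a]^N a N) ⟩
  suc a * (a * a * a * suc a ^ N)             ≡⟨ x∙yz≈y∙xz (suc a) (a * a * a) _ ⟩
  a * a * a * suc a ^ suc N                   ∎
  where open ≤-Reasoning

-- φ-num x / φ-den x = (1 + 1/x)^(2x+1)
φ-num φ-den : ℕ → ℕ
φ-num x = suc x ^ x * suc x ^ x * suc x
φ-den x = x ^ x * x ^ x * x

φ-num≢0 : ∀ x → NonZero (φ-num x)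
φ-num≢0 x = m*n≢0 (suc x ^ x * suc x ^ x) (suc x) {{m*n≢0 _ _ {{m^n≢0 (suc x) x}} {{m^n≢0 (suc x) x}}}}

φ-den≢0 : ∀ x .{{_ : NonZero x}} → NonZero (φ-den x)
φ-den≢0 x = m*n≢0 (x ^ x * x ^ x) x {{m*n≢0 _ _ {{m^n≢0 x x}} {{m^n≢0 x x}}}}

φ-step-polynomial : ∀ j → let k = suc j; a = k * suc (suc k) in
  a * a * a * (suc (suc k) * suc (suc k)) ≤ binomialHead a (3 + 2 * j) * (suc k * suc k)
φ-step-polynomial j = *-cancelˡ-≤ 6 (begin
  6 * (a * a * a * (k+2 * k+2))                        ≤⟨ m≤m+n _ slack ⟩
  6 * (a * a * a * (k+2 * k+2)) + slack                ≡⟨ expand j ⟩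
  (6 * (a * a * a) + 6 * (N * (a * a)) + 3 * (N * (2 + 2 * j) * a) + N * (2 + 2 * j) * (1 + 2 * j)) * (k+1 * k+1)
    ≡⟨ cong₂ (λ c₂ c₃ → (6 * (a * a * a) + 6 * (N * (a * a)) + 3 * (c₂ * a) + c₃) * (k+1 * k+1))
             (2*[1+n]C2≡[1+n]*n (2 + 2 * j)) (6*[2+n]C3≡[2+n]*[1+n]*n (1 + 2 * j)) ⟨
  (6 * (a * a * a) + 6 * (N * (a * a)) + 3 * (2 * (N C 2) * a) + 6 * (N C 3)) * (k+1 * k+1)
    ≡⟨ regroup (a * a * a) (N * (a * a)) (N C 2) a (N C 3) (k+1 * k+1) ⟩
  6 * (binomialHead a N * (k+1 * k+1))                 ∎)
  where
  open ≤-Reasoning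
  k = suc j
  k+1 = suc k
  k+2 = suc k+1
  a = k * k+2
  N = 3 + 2 * j
  slack = 2 * (j * j * j * j * j) + 20 * (j * j * j * j) + 96 * (j * j * j) + 220 * (j * j) + 220 * j + 78
  expand : ∀ j → let k = suc j; a = k * suc (suc k); N = 3 + 2 * j in
    6 * (a * a * a * (suc (suc k) * suc (suc k)))
      + (2 * (j * j * j * j * j) + 20 * (j * j * j * j) + 96 * (j * j * j) + 220 * (j * j) + 220 * j + 78)
    ≡ (6 * (a * a * a) + 6 * (N * (a * a)) + 3 * (N * (2 + 2 * j) * a) + N * (2 + 2 * j) * (1 + 2 * j))
      * (suc k * suc k)
  expand = solve-∀
  regroup : ∀ x y c₂ a w c → (6 * x + 6 * y + 3 * (2 * c₂ * a) + 6 * w) * c ≡ 6 * ((x + y + c₂ * a + w) * c)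
  regroup = solve-∀

φ-step : ∀ j → φ-num (2 + j) * φ-den (1 + j) ≤ φ-num (1 + j) * φ-den (2 + j)
φ-step j = begin
  φ-num (suc k) * φ-den k  ≡⟨ lhs-shape ⟩
  a ^ N * (k+2 * k+2)      ≤⟨ *-cancelˡ-≤ (a * a * a) core ⟩
  suc a ^ N * (k+1 * k+1)  ≡⟨ rhs-shape ⟩
  φ-num k * φ-den (suc k)  ∎
  where
  open ≤-Reasoning
  k = suc j
  k+1 = suc k
  k+2 = suc k+1
  a = k * k+2
  N = 3 + 2 * j
  x^N : ∀ x → x ^ N ≡ x * (x ^ k * x ^ k)
  x^N x = cong (x *_) (trans (cong (x ^_) (2+2j≡k+k j)) (^-distribˡ-+-* x k k))
    where
    2+2j≡k+k : ∀ j → 2 + 2 * j ≡ suc j + suc j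
    2+2j≡k+k = solve-∀
  lhs-shape : φ-num (suc k) * φ-den k ≡ a ^ N * (k+2 * k+2)
  lhs-shape = begin-equality
    φ-num (suc k) * φ-den k                          ≡⟨ rearrange k (k ^ k) (k+2 ^ k) ⟩
    a * ((k ^ k * k+2 ^ k) * (k ^ k * k+2 ^ k)) * (k+2 * k+2)
      ≡⟨ cong (λ y → a * (y * y) * (k+2 * k+2)) (^-distribʳ-* k k+2 k) ⟨
    a * (a ^ k * a ^ k) * (k+2 * k+2)                ≡⟨ cong (_* (k+2 * k+2)) (x^N a) ⟨
    a ^ N * (k+2 * k+2)                              ∎
    where
    rearrange : ∀ k X Y → suc (suc k) * Y * (suc (suc k) * Y) * suc (suc k) * (X * X * k)
                        ≡ k * suc (suc k) * ((X * Y) * (X * Y)) * (suc (suc k) * suc (suc k))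
    rearrange = solve-∀
  rhs-shape : suc a ^ N * (k+1 * k+1) ≡ φ-num k * φ-den (suc k)
  rhs-shape = begin-equality
    suc a ^ N * (k+1 * k+1)                                ≡⟨ cong (_* (k+1 * k+1)) (x^N (suc a)) ⟩
    suc a * (suc a ^ k * suc a ^ k) * (k+1 * k+1)
      ≡⟨ cong (λ b → b * (b ^ k * b ^ k) * (k+1 * k+1)) (1+a≡[1+k]² j) ⟩
    k+1 * k+1 * ((k+1 * k+1) ^ k * (k+1 * k+1) ^ k) * (k+1 * k+1)
      ≡⟨ cong (λ z → k+1 * k+1 * (z * z) * (k+1 * k+1)) (^-distribʳ-* k+1 k+1 k) ⟩
    k+1 * k+1 * ((k+1 ^ k * k+1 ^ k) * (k+1 ^ k * k+1 ^ k)) * (k+1 * k+1) ≡⟨ rearrange k+1 (k+1 ^ k) ⟩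
    φ-num k * φ-den (suc k)                                ∎
    where
    1+a≡[1+k]² : ∀ j → suc (suc j * suc (suc (suc j))) ≡ suc (suc j) * suc (suc j)
    1+a≡[1+k]² = solve-∀
    rearrange : ∀ s Z → s * s * ((Z * Z) * (Z * Z)) * (s * s) ≡ Z * Z * s * (s * Z * (s * Z) * s)
    rearrange = solve-∀
  core : a * a * a * (a ^ N * (k+2 * k+2)) ≤ a * a * a * (suc a ^ N * (k+1 * k+1))
  core = begin
    a * a * a * (a ^ N * (k+2 * k+2))            ≡⟨ x∙yz≈y∙xz (a * a * a) (a ^ N) (k+2 * k+2) ⟩
    a ^ N * (a * a * a * (k+2 * k+2))            ≤⟨ *-monoʳ-≤ (a ^ N) (φ-step-polynomial j) ⟩
    a ^ N * (binomialHead a N * (k+1 * k+1))     ≡⟨ *-assoc (a ^ N) (binomialHead a N) (k+1 * k+1) ⟨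
    a ^ N * binomialHead a N * (k+1 * k+1)       ≤⟨ *-monoˡ-≤ (k+1 * k+1) (a^N*binomialHead≤a³*[1+a]^N a N) ⟩
    a * a * a * suc a ^ N * (k+1 * k+1)          ≡⟨ *-assoc (a * a * a) (suc a ^ N) (k+1 * k+1) ⟩
    a * a * a * (suc a ^ N * (k+1 * k+1))        ∎

-- a/b ≤ c/d ≤ e/f, cross-multiplied
ratio-≤-trans : ∀ {a b c d e f} .{{_ : NonZero (c * d)}} →
  a * d ≤ c * b → c * f ≤ e * d → a * f ≤ e * b
ratio-≤-trans {a} {b} {c} {d} {e} {f} ad≤cb cf≤ed = *-cancelˡ-≤ (c * d) (begin
  c * d * (a * f)      ≡⟨ shuffle c d a f ⟩
  a * d * (c * f)      ≤⟨ *-mono-≤ ad≤cb cf≤ed ⟩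
  c * b * (e * d)      ≡⟨ shuffle c b e d ⟩
  e * b * (c * d)      ≡⟨ *-comm (e * b) (c * d) ⟩
  c * d * (e * b)      ∎)
  where
  open ≤-Reasoning
  shuffle : ∀ w x y z → w * x * (y * z) ≡ y * x * (w * z)
  shuffle = solve-∀

ratio-antitone : (f g : ℕ → ℕ) → (∀ n → NonZero (f n * g n)) →
  (∀ n → f (suc n) * g n ≤ f n * g (suc n)) → ∀ {x y} → x ≤ y → f y * g x ≤ f x * g y
ratio-antitone f g fg≢0 step {x} x≤y = go (≤⇒≤′ x≤y)
  where
  go : ∀ {y} → x ≤′ y → f y * g x ≤ f x * g y
  go ≤′-refl          = ≤-refl
  go (≤′-step {n} x≤n) =
    ratio-≤-trans {f (suc n)} {g (suc n)} {f n} {g n} {f x} {g x} {{fg≢0 n}} (step n) (go x≤n)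

φ-antitone : ∀ {x y} → 1 ≤ x → x ≤ y → φ-num y * φ-den x ≤ φ-num x * φ-den y
φ-antitone {suc x} {suc y} _ (s≤s x≤y) =
  ratio-antitone (φ-num ∘ suc) (φ-den ∘ suc) φφ≢0 φ-step x≤y
  where
  φφ≢0 : ∀ n → NonZero (φ-num (suc n) * φ-den (suc n))
  φφ≢0 n = m*n≢0 _ _ {{φ-num≢0 (suc n)}} {{φ-den≢0 (suc n)}}

-- A Stirling-type bound for the mode of the binomial distribution

-- modeProbNum r k / modeProbDen r k = P(Bin(r + k, r/(r + k)) = r)
modeProbNum modeProbDen : ℕ → ℕ → ℕ
modeProbNum r k = (r + k) ! * r ^ r * k ^ k
modeProbDen r k = (r + k) ^ (r + k) * (r ! * k !)

StirlingBound : ℕ → ℕ → Set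
StirlingBound r k = (r + k) * (modeProbDen r k * modeProbDen r k) ≤ 8 * r * k * (modeProbNum r k * modeProbNum r k)

stirling-base : ∀ k .{{_ : NonZero k}} → StirlingBound 1 k
stirling-base k = begin
  suc k * (modeProbDen 1 k * modeProbDen 1 k)     ≡⟨ lhs k (suc k ^ k) (k !) ⟩
  c * (φ-num k * φ-den 1)                         ≤⟨ *-monoʳ-≤ c (φ-antitone {1} {k} ≤-refl (>-nonZero⁻¹ k)) ⟩
  c * (φ-num 1 * φ-den k)                         ≡⟨ rhs k (k ^ k) (k !) ⟩
  8 * 1 * k * (modeProbNum 1 k * modeProbNum 1 k) ∎
  where
  open ≤-Reasoning
  c = suc k * suc k * (k ! * k !)
  lhs : ∀ k Z F → suc k * (suc k * Z * (1 * F) * (suc k * Z * (1 * F)))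
                 ≡ suc k * suc k * (F * F) * (Z * Z * suc k * 1)
  lhs = solve-∀
  rhs : ∀ k K F → suc k * suc k * (F * F) * (8 * (K * K * k))
                 ≡ 8 * 1 * k * (suc k * F * 1 * K * (suc k * F * 1 * K))
  rhs = solve-∀

stirling-step : ∀ r k .{{_ : NonZero r}} .{{_ : NonZero k}} → StirlingBound r k → StirlingBound (suc r) k
stirling-step r@(suc _) k bound = begin
  suc m * (modeProbDen (suc r) k * modeProbDen (suc r) k)  ≡⟨ lhs m (suc m ^ m) r (r !) (k !) ⟩
  c * (P * φ-num m)
    ≤⟨ *-monoʳ-≤ c (ratio-≤-trans {P} {U} {φ-den r} {φ-den m} {φ-num r} {φ-num m} {{nz}} bound′ φ) ⟩
  c * (φ-num r * U)                                        ≡⟨ rhs m (m !) r (suc r ^ r) k (k ^ k) ⟩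
  8 * suc r * k * (modeProbNum (suc r) k * modeProbNum (suc r) k) ∎
  where
  open ≤-Reasoning
  m = r + k
  P = r ! * k ! * (r ! * k !)
  U = 8 * k * (m ! * k ^ k * (m ! * k ^ k))
  c = suc m * suc m * (suc r * suc r)
  nz : NonZero (φ-den r * φ-den m)
  nz = m*n≢0 _ _ {{φ-den≢0 r}} {{φ-den≢0 m}}
  bound′ : P * φ-den m ≤ φ-den r * U
  bound′ = begin
    P * φ-den m                                        ≡⟨ bound-lhs m (m ^ m) (r ! * k !) ⟩
    m * (modeProbDen r k * modeProbDen r k)            ≤⟨ bound ⟩
    8 * r * k * (modeProbNum r k * modeProbNum r k)    ≡⟨ bound-rhs r (r ^ r) k (m !) (k ^ k) ⟩
    φ-den r * U                                        ∎
    where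
    bound-lhs : ∀ m M F → F * F * (M * M * m) ≡ m * (M * F * (M * F))
    bound-lhs = solve-∀
    bound-rhs : ∀ r R k F K → 8 * r * k * (F * R * K * (F * R * K)) ≡ R * R * r * (8 * k * (F * K * (F * K)))
    bound-rhs = solve-∀
  φ : φ-den r * φ-num m ≤ φ-num r * φ-den m
  φ = ≤-trans (≤-reflexive (*-comm (φ-den r) (φ-num m))) (φ-antitone (>-nonZero⁻¹ r) (m≤m+n r k))
  lhs : ∀ m M r F G → suc m * (suc m * M * (suc r * F * G) * (suc m * M * (suc r * F * G)))
                   ≡ suc m * suc m * (suc r * suc r) * (F * G * (F * G) * (M * M * suc m))
  lhs = solve-∀
  rhs : ∀ m F r R k K → suc m * suc m * (suc r * suc r) * (R * R * suc r * (8 * k * (F * K * (F * K))))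
                     ≡ 8 * suc r * k * (suc m * F * (suc r * R) * K * (suc m * F * (suc r * R) * K))
  rhs = solve-∀

stirling-bound : ∀ r k .{{_ : NonZero r}} .{{_ : NonZero k}} → StirlingBound r k
stirling-bound (suc zero)    k = stirling-base k
stirling-bound (suc (suc r)) k = stirling-step (suc r) k (stirling-bound (suc r) k)

m*m≤n*n⇒m≤n : ∀ {m n} → m * m ≤ n * n → m ≤ n
m*m≤n*n⇒m≤n m*m≤n*n = ≮⇒≥ (λ n<m → <⇒≱ (*-mono-< n<m n<m) m*m≤n*n)

4*m*n≤[m+n]*[m+n] : ∀ m n → 4 * m * n ≤ (m + n) * (m + n)
4*m*n≤[m+n]*[m+n] m n =
  [ ordered , (λ n≤m → subst₂ _≤_ (swap₄ n m) (swap₂ n m) (ordered n≤m)) ]′ (≤-total m n)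
  where
  swap₄ : ∀ a b → 4 * a * b ≡ 4 * b * a
  swap₄ = solve-∀
  swap₂ : ∀ a b → (a + b) * (a + b) ≡ (b + a) * (b + a)
  swap₂ = solve-∀
  ordered : ∀ {a b} → a ≤ b → 4 * a * b ≤ (a + b) * (a + b)
  ordered {a} {b} a≤b = subst (λ b → 4 * a * b ≤ (a + b) * (a + b)) (m+[n∸m]≡n a≤b)
    (≤-trans (m≤m+n _ ((b ∸ a) * (b ∸ a))) (≤-reflexive (square a (b ∸ a))))
    where
    square : ∀ a d → 4 * a * (a + d) + d * d ≡ (a + (a + d)) * (a + (a + d))
    square = solve-∀

modeProb-zeroˡ : ∀ k → modeProbDen 0 k ≡ modeProbNum 0 k
modeProb-zeroˡ k = swap (k ^ k) (k !)
  where
  swap : ∀ K F → K * (1 * F) ≡ F * 1 * K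
  swap = solve-∀

modeProb-zeroʳ : ∀ r → modeProbDen r 0 ≡ modeProbNum r 0
modeProb-zeroʳ r = begin
  (r + 0) ^ (r + 0) * (r ! * 1)  ≡⟨ cong (λ m → m ^ m * (r ! * 1)) (+-identityʳ r) ⟩
  r ^ r * (r ! * 1)              ≡⟨ swap (r ^ r) (r !) ⟩
  r ! * r ^ r * 1                ≡⟨ cong (λ m → m ! * r ^ r * 1) (+-identityʳ r) ⟨
  (r + 0) ! * r ^ r * 1          ∎
  where
  open ≡-Reasoning
  swap : ∀ R F → R * (F * 1) ≡ F * R * 1
  swap = solve-∀

2*m≤n*n⇒n≢0 : ∀ {m n} → 1 ≤ m → 2 * m ≤ n * n → NonZero n
2*m≤n*n⇒n≢0 {m} {zero}  1≤m 2m≤0 = contradiction (≤-trans 1≤m (≤-trans (m≤m+n m _) 2m≤0)) λ ()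
2*m≤n*n⇒n≢0 {m} {suc n} _   _    = _

mode-bound : ∀ n r k .{{_ : NonZero n}} → 2 * (r + k) ≤ n * n → modeProbDen r k ≤ n * modeProbNum r k
mode-bound n zero k _ = ≤-trans (≤-reflexive (modeProb-zeroˡ k)) (m≤n*m _ n)
mode-bound n r@(suc _) zero _ = ≤-trans (≤-reflexive (modeProb-zeroʳ r)) (m≤n*m _ n)
mode-bound n r@(suc _) k@(suc _) 2m≤n*n = m*m≤n*n⇒m≤n (*-cancelˡ-≤ m (begin
  m * (D * D)                ≤⟨ stirling-bound r k ⟩
  8 * r * k * (N * N)        ≡⟨ regroup r k (N * N) ⟩
  2 * (4 * r * k) * (N * N)  ≤⟨ *-monoˡ-≤ (N * N) (*-monoʳ-≤ 2 (4*m*n≤[m+n]*[m+n] r k)) ⟩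
  2 * (m * m) * (N * N)      ≡⟨ regroup′ m (N * N) ⟩
  m * (2 * m * (N * N))      ≤⟨ *-monoʳ-≤ m (*-monoˡ-≤ (N * N) 2m≤n*n) ⟩
  m * (n * n * (N * N))      ≡⟨ cong (m *_) (swap n N) ⟩
  m * (n * N * (n * N))      ∎))
  where
  open ≤-Reasoning
  m = r + k
  D = modeProbDen r k
  N = modeProbNum r k
  regroup : ∀ r k x → 8 * r * k * x ≡ 2 * (4 * r * k) * x
  regroup = solve-∀
  regroup′ : ∀ m x → 2 * (m * m) * x ≡ m * (2 * m * x)
  regroup′ = solve-∀
  swap : ∀ n N → n * n * (N * N) ≡ n * N * (n * N)
  swap = solve-∀

-- Counting the edges of a simple graph

∑-mono-≤ : ∀ {n} {f g : Fin n → ℕ} → (∀ i → f i ≤ g i) → ∑[ i < n ] f i ≤ ∑[ i < n ] g i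
∑-mono-≤ {zero}  f≤g = z≤n
∑-mono-≤ {suc n} f≤g = +-mono-≤ (f≤g zero) (∑-mono-≤ (f≤g ∘ suc))

∑-const : ∀ n c → ∑[ i < n ] c ≡ n * c
∑-const zero    c = refl
∑-const (suc n) c = cong (c +_) (∑-const n c)

length-concatMap-tabulate : ∀ {A B : Set} {n} (f : A → List B) (g : Fin n → A) →
  length (concatMap f (tabulate g)) ≡ ∑[ i < n ] length (f (g i))
length-concatMap-tabulate {n = zero}  f g = refl
length-concatMap-tabulate {n = suc n} f g =
  trans (length-++ (f (g zero))) (cong (length (f (g zero)) +_) (length-concatMap-tabulate f (g ∘ suc)))

below : ∀ {n} → Fin n → Fin n → ℕ
below i j = if isYes (i Fin.<? j) then 1 else 0

below+below≤1 : ∀ {n} (i j : Fin n) → below i j + below j i ≤ 1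
below+below≤1 i j with i Fin.<? j | j Fin.<? i
... | yes i<j | yes j<i = contradiction i<j (Fin.<-asym j<i)
... | yes _   | no _    = ≤-refl
... | no _    | yes _   = ≤-refl
... | no _    | no _    = z≤n

2*∑∑below≤n*n : ∀ n → 2 * ∑[ i < n ] ∑[ j < n ] below i j ≤ n * n
2*∑∑below≤n*n n = begin
  2 * S                                                  ≡⟨ cong (S +_) (+-identityʳ S) ⟩
  S + S                                                  ≡⟨ cong (S +_) (∑-comm {n} {n} below) ⟩
  S + ∑[ i < n ] ∑[ j < n ] below j i                    ≡⟨ ∑-distrib-+ {n} (λ i → ∑[ j < n ] below i j) _ ⟨
  ∑[ i < n ] (∑[ j < n ] below i j + ∑[ j < n ] below j i)
    ≡⟨ sum-cong-≗ {n} (λ i → ∑-distrib-+ {n} (below i) (λ j → below j i)) ⟨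
  ∑[ i < n ] ∑[ j < n ] (below i j + below j i)          ≤⟨ ∑-mono-≤ {n} (λ i → ∑-mono-≤ {n} (below+below≤1 i)) ⟩
  ∑[ i < n ] ∑[ j < n ] 1                                ≡⟨ sum-cong-≗ {n} (λ _ → ∑-const n 1) ⟩
  ∑[ i < n ] (n * 1)                                     ≡⟨ ∑-const n (n * 1) ⟩
  n * (n * 1)                                            ≡⟨ cong (n *_) (*-identityʳ n) ⟩
  n * n                                                  ∎
  where
  open ≤-Reasoning
  S = ∑[ i < n ] ∑[ j < n ] below i j

2*numEdges≤n*n : ∀ {n} (G : SimpleGraph n) → 2 * numEdges G ≤ n * n
2*numEdges≤n*n {n} G = begin
  2 * numEdges G                                ≡⟨ cong (2 *_) count ⟩
  2 * ∑[ i < n ] ∑[ j < n ] length (edge i j)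
    ≤⟨ *-monoʳ-≤ 2 (∑-mono-≤ {n} (λ i → ∑-mono-≤ {n} (edge≤below i))) ⟩
  2 * ∑[ i < n ] ∑[ j < n ] below i j           ≤⟨ 2*∑∑below≤n*n n ⟩
  n * n                                         ∎
  where
  open ≤-Reasoning
  edge : Fin n → Fin n → List (Fin n × Fin n)
  edge i j = if adj G i j ∧ isYes (i Fin.<? j) then [ (i , j) ] else []
  count : numEdges G ≡ ∑[ i < n ] ∑[ j < n ] length (edge i j)
  count = trans (length-concatMap-tabulate (λ i → concatMap (edge i) (tabulate id)) id)
                (sum-cong-≗ {n} (λ i → length-concatMap-tabulate (edge i) id))
  edge≤below : ∀ i j → length (edge i j) ≤ below i j
  edge≤below i j with adj G i j | isYes (i Fin.<? j)
  ... | true  | true  = ≤-refl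
  ... | true  | false = z≤n
  ... | false | _     = z≤n

-- Binomial probabilities

-- P(Bin(m, p) = r), with q = 1 − p as a separate argument so that p and q can both be fractions k/m
binomialPmf : ℚ → ℚ → ℕ → ℕ → ℚ
binomialPmf p q zero    zero    = 1ℚ
binomialPmf p q zero    (suc r) = 0ℚ
binomialPmf p q (suc m) zero    = q ℚ.* binomialPmf p q m zero
binomialPmf p q (suc m) (suc r) = p ℚ.* binomialPmf p q m r ℚ.+ q ℚ.* binomialPmf p q m (suc r)

sumℚ-++ : (xs ys : List ℚ) → sumℚ (xs ++ ys) ≡ sumℚ xs ℚ.+ sumℚ ys
sumℚ-++ []       ys = sym (ℚ.+-identityˡ (sumℚ ys))
sumℚ-++ (x ∷ xs) ys = trans (cong (x ℚ.+_) (sumℚ-++ xs ys)) (sym (ℚ.+-assoc x (sumℚ xs) (sumℚ ys)))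

sumℚ-zeros : ∀ {A : Set} (xs : List A) → sumℚ (map (λ _ → 0ℚ) xs) ≡ 0ℚ
sumℚ-zeros []       = refl
sumℚ-zeros (x ∷ xs) = trans (ℚ.+-identityˡ _) (sumℚ-zeros xs)

sumℚ-if-* : ∀ {A : Set} (P : A → Bool) c (w : A → ℚ) xs →
  sumℚ (map (λ x → if P x then c ℚ.* w x else 0ℚ) xs)
  ≡ c ℚ.* sumℚ (map (λ x → if P x then w x else 0ℚ) xs)
sumℚ-if-* P c w []       = sym (ℚ.*-zeroʳ c)
sumℚ-if-* P c w (x ∷ xs) with P x
... | true  = trans (cong (c ℚ.* w x ℚ.+_) (sumℚ-if-* P c w xs)) (sym (ℚ.*-distribˡ-+ c (w x) _))
... | false = trans (ℚ.+-identityˡ _) (trans (sumℚ-if-* P c w xs) (cong (c ℚ.*_) (sym (ℚ.+-identityˡ _))))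

sumℚ-masks-suc : ∀ (F : List Bool → ℚ) k → sumℚ (map F (masks (suc k)))
               ≡ sumℚ (map (F ∘ (true ∷_)) (masks k)) ℚ.+ sumℚ (map (F ∘ (false ∷_)) (masks k))
sumℚ-masks-suc F k = trans (cong sumℚ (map-++ F (map (true ∷_) M) (map (false ∷_) M)))
  (trans (sumℚ-++ (map F (map (true ∷_) M)) _)
         (cong₂ ℚ._+_ (cong sumℚ (sym (map-∘ M))) (cong sumℚ (sym (map-∘ M)))))
  where M = masks k

sumℚ-masks≡binomialPmf : ∀ {A : Set} p (xs : List A) r →
  sumℚ (map (λ b → if length (select b xs) ≡ᵇ r then weight p b else 0ℚ) (masks (length xs)))
  ≡ binomialPmf p (1ℚ ℚ.- p) (length xs) r
sumℚ-masks≡binomialPmf p []       zero    = refl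
sumℚ-masks≡binomialPmf p []       (suc r) = refl
sumℚ-masks≡binomialPmf p (x ∷ xs) r       = trans (sumℚ-masks-suc (F r) (length xs)) (split r)
  where
  M = masks (length xs)
  q = 1ℚ ℚ.- p
  F : ℕ → List Bool → ℚ
  F r b = if length (select b (x ∷ xs)) ≡ᵇ r then weight p b else 0ℚ
  scaled : ∀ c r → sumℚ (map (λ b → if length (select b xs) ≡ᵇ r then c ℚ.* weight p b else 0ℚ) M)
                 ≡ c ℚ.* binomialPmf p q (length xs) r
  scaled c r = trans (sumℚ-if-* (λ b → length (select b xs) ≡ᵇ r) c (weight p) M)
                     (cong (c ℚ.*_) (sumℚ-masks≡binomialPmf p xs r))
  split : ∀ r → sumℚ (map (F r ∘ (true ∷_)) M) ℚ.+ sumℚ (map (F r ∘ (false ∷_)) M)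
              ≡ binomialPmf p q (suc (length xs)) r
  split zero    = trans (cong₂ ℚ._+_ (sumℚ-zeros M) (scaled q zero)) (ℚ.+-identityˡ _)
  split (suc r) = cong₂ ℚ._+_ (scaled p r) (scaled q (suc r))

toℚᵘ-frac : ∀ a d .{{_ : NonZero d}} → ℚ.toℚᵘ (frac a d) ℚᵘ.≃ (ℤ.+ a ℚᵘ./ d)
toℚᵘ-frac a (suc d) = ℚ.toℚᵘ-fromℚᵘ (ℚᵘ.mkℚᵘ (ℤ.+ a) d)

frac-* : ∀ a b c d .{{_ : NonZero b}} .{{_ : NonZero d}} → frac a b ℚ.* frac c d ≡ frac (a * c) (b * d)
frac-* a b@(suc _) c d@(suc _) = ℚ.toℚᵘ-injective (ℚᵘ.≃-trans (ℚ.toℚᵘ-homo-* (frac a b) (frac c d))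
  (ℚᵘ.≃-trans (ℚᵘ.*-cong (toℚᵘ-frac a b) (toℚᵘ-frac c d))
  (ℚᵘ.≃-trans (ℚᵘ.*≡* (cong (ℤ._* ℤ.+ (b * d)) (sym (ℤ.pos-* a c))))
               (ℚᵘ.≃-sym (toℚᵘ-frac (a * c) (b * d))))))

frac-+ : ∀ a c d .{{_ : NonZero d}} → frac a d ℚ.+ frac c d ≡ frac (a + c) d
frac-+ a c d@(suc _) = ℚ.toℚᵘ-injective (ℚᵘ.≃-trans (ℚ.toℚᵘ-homo-+ (frac a d) (frac c d))
  (ℚᵘ.≃-trans (ℚᵘ.+-cong (toℚᵘ-frac a d) (toℚᵘ-frac c d))
  (ℚᵘ.≃-trans (ℚᵘ.*≡* cross) (ℚᵘ.≃-sym (toℚᵘ-frac (a + c) d)))))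
  where
  cross : (ℤ.+ a ℤ.* ℤ.+ d ℤ.+ ℤ.+ c ℤ.* ℤ.+ d) ℤ.* ℤ.+ d ≡ ℤ.+ (a + c) ℤ.* ℤ.+ (d * d)
  cross = trans (distrib (ℤ.+ a) (ℤ.+ c) (ℤ.+ d)) (sym (cong₂ ℤ._*_ (ℤ.pos-+ a c) (ℤ.pos-* d d)))
    where
    distrib : ∀ a c d → (a ℤ.* d ℤ.+ c ℤ.* d) ℤ.* d ≡ (a ℤ.+ c) ℤ.* (d ℤ.* d)
    distrib = ℤ-solve-∀

frac-≤ : ∀ a b c d .{{_ : NonZero b}} .{{_ : NonZero d}} → a * d ≤ c * b → frac a b ≤ℚ frac c d
frac-≤ a b@(suc _) c d@(suc _) ad≤cb = ℚ.toℚᵘ-cancel-≤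
  (ℚᵘ.≤-respʳ-≃ (ℚᵘ.≃-sym (toℚᵘ-frac c d)) (ℚᵘ.≤-respˡ-≃ (ℚᵘ.≃-sym (toℚᵘ-frac a b))
    (ℚᵘ.*≤* (subst₂ ℤ._≤_ (ℤ.pos-* a d) (ℤ.pos-* c b) (+≤+ ad≤cb)))))

frac-d-d : ∀ d .{{_ : NonZero d}} → frac d d ≡ 1ℚ
frac-d-d d@(suc _) =
  ℚ.toℚᵘ-injective (ℚᵘ.≃-trans (toℚᵘ-frac d d) (ℚᵘ.*≡* (ℤ.*-comm (ℤ.+ d) (ℤ.+ 1))))

1-frac : ∀ r k .{{_ : NonZero (r + k)}} → 1ℚ ℚ.- frac r (r + k) ≡ frac k (r + k)
1-frac r k = begin
  1ℚ ℚ.- frac r m                              ≡⟨ cong (ℚ._- frac r m) (trans (frac-+ r k m) (frac-d-d m)) ⟨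
  frac r m ℚ.+ frac k m ℚ.- frac r m            ≡⟨ xyx⁻¹≈y (frac r m) (frac k m) ⟩
  frac k m                                     ∎
  where
  open ≡-Reasoning
  open AbelianGroupProperties ℚ.+-0-abelianGroup using (xyx⁻¹≈y)
  m = r + k

binomialWeight : ℕ → ℕ → ℕ → ℕ → ℕ
binomialWeight a b zero    zero    = 1
binomialWeight a b zero    (suc i) = 0
binomialWeight a b (suc m) zero    = b * binomialWeight a b m zero
binomialWeight a b (suc m) (suc i) = a * binomialWeight a b m i + b * binomialWeight a b m (suc i)

binomialPmf-frac : ∀ a b d m i .{{_ : NonZero d}} →
  binomialPmf (frac a d) (frac b d) m i ≡ frac (binomialWeight a b m i) (d ^ m)
binomialPmf-frac a b d zero    zero    = refl
binomialPmf-frac a b d zero    (suc i) = refl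
binomialPmf-frac a b d (suc m) zero    = trans (cong (frac b d ℚ.*_) (binomialPmf-frac a b d m zero))
  (frac-* b d (binomialWeight a b m zero) (d ^ m))
  where instance _ = m^n≢0 d m
binomialPmf-frac a b d (suc m) (suc i) = trans
  (cong₂ (λ x y → frac a d ℚ.* x ℚ.+ frac b d ℚ.* y)
         (binomialPmf-frac a b d m i) (binomialPmf-frac a b d m (suc i)))
  (trans (cong₂ ℚ._+_ (frac-* a d (binomialWeight a b m i) (d ^ m))
                      (frac-* b d (binomialWeight a b m (suc i)) (d ^ m)))
         (frac-+ _ _ (d ^ suc m)))
  where instance
    _ = m^n≢0 d m
    _ = m^n≢0 d (suc m)

binomialWeight-vanishes : ∀ a b {m i} → m < i → binomialWeight a b m i ≡ 0
binomialWeight-vanishes a b {zero}  {suc i} _ = refl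
binomialWeight-vanishes a b {suc m} {suc i} (s≤s m<i) = cong₂ _+_
  (trans (cong (a *_) (binomialWeight-vanishes a b m<i)) (*-zeroʳ a))
  (trans (cong (b *_) (binomialWeight-vanishes a b (m<n⇒m<1+n m<i))) (*-zeroʳ b))

binomialWeight*i!*l! : ∀ a b i l → binomialWeight a b (i + l) i * i ! * l ! ≡ (i + l) ! * a ^ i * b ^ l
binomialWeight*i!*l! a b zero zero = refl
binomialWeight*i!*l! a b zero (suc l) = begin
  b * W * 1 * (suc l * l !)        ≡⟨ e₁ b (suc l) W (l !) ⟩
  suc l * b * (W * 1 * l !)        ≡⟨ cong (suc l * b *_) (binomialWeight*i!*l! a b zero l) ⟩
  suc l * b * (l ! * 1 * b ^ l)    ≡⟨ e₂ b (suc l) (l !) (b ^ l) ⟩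
  suc l * l ! * 1 * (b * b ^ l)    ∎
  where
  open ≡-Reasoning
  W = binomialWeight a b l zero
  e₁ : ∀ b s W F → b * W * 1 * (s * F) ≡ s * b * (W * 1 * F)
  e₁ = solve-∀
  e₂ : ∀ b s F B → s * b * (F * 1 * B) ≡ s * F * 1 * (b * B)
  e₂ = solve-∀
binomialWeight*i!*l! a b (suc i) zero = begin
  (a * X + b * Y) * (suc i * i !) * 1      ≡⟨ cong (λ y → (a * X + b * y) * (suc i * i !) * 1) Y≡0 ⟩
  (a * X + b * 0) * (suc i * i !) * 1      ≡⟨ e₁ a b (suc i) X (i !) ⟩
  suc i * a * (X * i ! * 1)                ≡⟨ cong (suc i * a *_) (binomialWeight*i!*l! a b i zero) ⟩
  suc i * a * ((i + 0) ! * a ^ i * 1)      ≡⟨ e₂ a i ((i + 0) !) (a ^ i) ⟩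
  suc (i + 0) * (i + 0) ! * (a * a ^ i) * 1 ∎
  where
  open ≡-Reasoning
  X = binomialWeight a b (i + 0) i
  Y = binomialWeight a b (i + 0) (suc i)
  Y≡0 : Y ≡ 0
  Y≡0 = binomialWeight-vanishes a b (s≤s (≤-reflexive (+-identityʳ i)))
  e₁ : ∀ a b s X F → (a * X + b * 0) * (s * F) * 1 ≡ s * a * (X * F * 1)
  e₁ = solve-∀
  e₂ : ∀ a i F A → suc i * a * (F * A * 1) ≡ suc (i + 0) * F * (a * A) * 1
  e₂ = solve-∀
binomialWeight*i!*l! a b (suc i) (suc l) = begin
  (a * X + b * Y) * (suc i * i !) * (suc l * l !)
    ≡⟨ e₁ a b (suc i) (suc l) X Y (i !) (l !) ⟩
  a * suc i * (X * i ! * (suc l * l !)) + b * suc l * (Y * (suc i * i !) * l !)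
    ≡⟨ cong₂ (λ x y → a * suc i * x + b * suc l * y) (binomialWeight*i!*l! a b i (suc l)) ih₂ ⟩
  a * suc i * (F * a ^ i * (b * b ^ l)) + b * suc l * (F * (a * a ^ i) * b ^ l)
    ≡⟨ e₂ a b i l F (a ^ i) (b ^ l) ⟩
  suc (i + suc l) * F * (a * a ^ i) * (b * b ^ l) ∎
  where
  open ≡-Reasoning
  X = binomialWeight a b (i + suc l) i
  Y = binomialWeight a b (i + suc l) (suc i)
  F = (i + suc l) !
  ih₂ : Y * (suc i * i !) * l ! ≡ F * (a * a ^ i) * b ^ l
  ih₂ = subst (λ m → binomialWeight a b m (suc i) * (suc i * i !) * l ! ≡ m ! * (a * a ^ i) * b ^ l)
              (sym (+-suc i l)) (binomialWeight*i!*l! a b (suc i) l)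
  e₁ : ∀ a b si sl X Y Fi Fl → (a * X + b * Y) * (si * Fi) * (sl * Fl)
                             ≡ a * si * (X * Fi * (sl * Fl)) + b * sl * (Y * (si * Fi) * Fl)
  e₁ = solve-∀
  e₂ : ∀ a b i l F A B → a * suc i * (F * A * (b * B)) + b * suc l * (F * (a * A) * B)
                       ≡ suc (i + suc l) * F * (a * A) * (b * B)
  e₂ = solve-∀

binomialPmf-mode-≥ : ∀ n m r → 1 ≤ m → r ≤ m → 2 * m ≤ n * n →
  frac 1 n ≤ℚ binomialPmf (frac r m) (1ℚ ℚ.- frac r m) m r
binomialPmf-mode-≥ n m r 1≤m r≤m 2m≤n*n with m ∸ r | m+[n∸m]≡n r≤m
binomialPmf-mode-≥ n .(r + k) r 1≤m r≤m 2m≤n*n | k | refl = begin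
  frac 1 n                                      ≤⟨ frac-≤ 1 n W (m ^ m) 1*mᵐ≤W*n ⟩
  frac W (m ^ m)                                ≡⟨ binomialPmf-frac r k m m r ⟨
  binomialPmf (frac r m) (frac k m) m r         ≡⟨ cong (λ q → binomialPmf (frac r m) q m r) (1-frac r k) ⟨
  binomialPmf (frac r m) (1ℚ ℚ.- frac r m) m r  ∎
  where
  open ℚ.≤-Reasoning
  m = r + k
  W = binomialWeight r k m r
  instance
    _ = >-nonZero 1≤m
    _ = 2*m≤n*n⇒n≢0 1≤m 2m≤n*n
    _ = m^n≢0 m m
  n*modeProbNum≡n*W*r!k! : n * modeProbNum r k ≡ n * W * (r ! * k !)
  n*modeProbNum≡n*W*r!k! = trans (cong (n *_) (sym (binomialWeight*i!*l! r k r k))) (shuffle n W (r !) (k !))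
    where
    shuffle : ∀ n W F G → n * (W * F * G) ≡ n * W * (F * G)
    shuffle = solve-∀
  mᵐ≤n*W : m ^ m ≤ n * W
  mᵐ≤n*W = *-cancelʳ-≤ (m ^ m) (n * W) (r ! * k !) {{r !* k !≢0}}
    (subst (m ^ m * (r ! * k !) ≤_) n*modeProbNum≡n*W*r!k! (mode-bound n r k 2m≤n*n))
  1*mᵐ≤W*n : 1 * m ^ m ≤ W * n
  1*mᵐ≤W*n = subst₂ _≤_ (sym (*-identityˡ (m ^ m))) (*-comm n W) mᵐ≤n*W

lemma16 : (n : ℕ) (G : SimpleGraph n) → 1 ≤ numEdges G → (r : ℕ) → r ≤ numEdges G →
    frac 1 n ≤ℚ probEdgeCount G (frac r (numEdges G)) r
lemma16 n G 1≤m r r≤m =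
  subst (frac 1 n ≤ℚ_) (sym (sumℚ-masks≡binomialPmf (frac r (numEdges G)) (edges G) r))
        (binomialPmf-mode-≥ n (numEdges G) r 1≤m r≤m (2*numEdges≤n*n G))
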